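{- Let $\delta=(\delta_1,\dots,\delta_r)$ be a composition of $k$ and let $\hat\omega$ be the minimal sequence in $\Omega_\delta$. Then: (1) if $z_\ell:=\delta_1+\cdots+\delta_{\ell-1}+1$ is the first element of $N^\delta_\ell$, then $\hat\omega_{z_\ell}=\ell$; (2) $\max\{\hat\omega_i:i\in N^\delta_\ell\}=\ell$; (3) if $p:=\hat\omega_i>\hat\omega_{i+1}=:m$, then $|\{j\le i:\hat\omega_j=m\}|=|\{j\le i:\hat\omega_j=p\}|$.
   Context: A composition of $k$ is a finite sequence of positive integers summing to $k$. $N^\delta_\ell:=\{\delta_1+\cdots+\delta_{\ell-1}+1,\dots,\delta_1+\cdots+\delta_\ell\}$. A lattice permutation is a finite sequence $(\omega_1,\dots,\omega_s)$ of positive integers such that for each $k'\le s$ and each $a<b$, $|\{i\le k':\omega_i=a\}|\ge|\{i\le k':\omega_i=b\}|$. A sequence of length $m\le k$ is $\delta$-nonincreasing if, after appending $k-m$ entries equal to $1$, it is nonincreasing on each $N^\delta_\ell$. $\Omega_\delta$ is the set of sequences of $k$ positive integers that are lattice permutations and $\delta$-nonincreasing. The minimal sequence $\hat\omega\in\Omega_\delta$ is defined recursively: $\hat\omega_1=1$, and given $\hat\omega_1,\dots,\hat\omega_{i-1}$, $\hat\omega_i$ is the largest positive integer such that $(\hat\omega_1,\dots,\hat\omega_i)$ is a lattice permutation and $\delta$-nonincreasing. -}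

module Defs where

open import Data.Nat using (ℕ; zero; suc; _+_; _∸_; _≤_; _<_; _⊔_)
open import Data.Nat.ListAction using (sum)
open import Data.List using (List; []; _∷_; length; take; drop; replicate; _++_; foldr; [_])
open import Data.List.Relation.Unary.All using (All)
open import Data.Product using (_×_)
open import Relation.Nullary using (¬_)
open import Relation.Binary.PropositionalEquality using (_≡_)
open import Data.Nat using (_≟_)
open import Relation.Nullary using (yes; no)

-- 1-indexed access; value 0 outside the range (never used there).
get : List ℕ → ℕ → ℕ
get []       _             = 0
get (x ∷ xs) zero          = 0
get (x ∷ xs) (suc zero)    = x
get (x ∷ xs) (suc (suc i)) = get xs (suc i)

count : ℕ → List ℕ → ℕ
count a []       = 0
count a (x ∷ xs) with a ≟ x
... | yes _ = suc (count a xs)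
... | no  _ = count a xs

Composition : List ℕ → Set
Composition δ = All (λ d → 1 ≤ d) δ

Positive : List ℕ → Set
Positive xs = All (λ x → 1 ≤ x) xs

Lattice : List ℕ → Set
Lattice xs = ∀ k′ → k′ ≤ length xs → ∀ a b → 1 ≤ a → a < b →
  count b (take k′ xs) ≤ count a (take k′ xs)

-- first and last element of N^δ_ℓ (ℓ is 1-indexed)
zStart : List ℕ → ℕ → ℕ
zStart δ ℓ = sum (take (ℓ ∸ 1) δ) + 1

zEnd : List ℕ → ℕ → ℕ
zEnd δ ℓ = sum (take ℓ δ)

pad : List ℕ → List ℕ → List ℕ
pad δ xs = xs ++ replicate (sum δ ∸ length xs) 1

DeltaNonincreasing : List ℕ → List ℕ → Set
DeltaNonincreasing δ xs = length xs ≤ sum δ ×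
  (∀ ℓ → 1 ≤ ℓ → ℓ ≤ length δ → ∀ i j → zStart δ ℓ ≤ i → i ≤ j → j ≤ zEnd δ ℓ →
     get (pad δ xs) j ≤ get (pad δ xs) i)

Admissible : List ℕ → List ℕ → Set
Admissible δ xs = Positive xs × Lattice xs × DeltaNonincreasing δ xs

-- ω is the minimal sequence ω̂ of Ω_δ, via its recursive definition:
-- length k, and each ω_i is the largest positive integer v such that
-- (ω_1,…,ω_{i-1},v) is a lattice permutation and δ-nonincreasing.
IsMinimalSeq : List ℕ → List ℕ → Set
IsMinimalSeq δ ω = length ω ≡ sum δ ×
  (∀ i → 1 ≤ i → i ≤ length ω →
     Admissible δ (take i ω) ×
     (∀ v → get ω i < v → ¬ Admissible δ (take (i ∸ 1) ω ++ [ v ])))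

blockMax : List ℕ → List ℕ → ℕ → ℕ
blockMax δ ω ℓ = foldr _⊔_ 0 (take (get δ ℓ) (drop (zStart δ ℓ ∸ 1) ω))

-- ω̂ is greedy: each entry is the largest value keeping the prefix admissible.
-- The lattice condition caps ω̂_{t+1} by 1 + max(ω̂_1,…,ω̂_t), and this value is
-- always lattice-admissible; at the first position of a block the
-- δ-nonincreasing condition imposes nothing, so there ω̂ attains the cap, while
-- inside a block the entries do not exceed the block's first entry. Hence the
-- running maximum grows by exactly one per block, which gives (1) and (2).
-- For (3), every v with m < v ≤ p is allowed by δ-monotonicity at position
-- i + 1, so greediness forces v to violate the lattice condition, i.e. v and
-- v − 1 occur equally often among ω̂_1,…,ω̂_i; chaining from m to p gives (3).
module Submission where

open import Defs
open import Data.Nat using (ℕ; zero; suc; _+_; _∸_; _≤_; _<_; _⊔_; z≤n; s≤s; s≤s⁻¹; _≟_; _≤?_; _<?_; pred)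
open import Data.Nat.Properties
open import Data.Nat.ListAction using (sum)
open import Data.List using (List; []; _∷_; length; take; drop; replicate; _++_; foldr; [_])
open import Data.List.Properties using (++-assoc; take-all; length-take; length-++)
open import Data.List.Relation.Unary.All using (All; []; _∷_)
open import Data.List.Relation.Unary.All.Properties using (++⁺)
open import Data.Product using (_×_; _,_; proj₁; proj₂)
open import Data.Sum using (inj₁; inj₂)
open import Data.Empty using (⊥; ⊥-elim)
open import Relation.Nullary using (¬_; yes; no)
open import Function using (_∘′_)
open import Relation.Binary.PropositionalEquality hiding ([_])

get-zero : ∀ xs → get xs 0 ≡ 0
get-zero []       = refl
get-zero (x ∷ xs) = refl

get-++ˡ : ∀ xs ys j → j ≤ length xs → get (xs ++ ys) j ≡ get xs j
get-++ˡ []       ys zero          _       = get-zero ys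
get-++ˡ (x ∷ xs) ys zero          _       = refl
get-++ˡ (x ∷ xs) ys (suc zero)    _       = refl
get-++ˡ (x ∷ xs) ys (suc (suc j)) (s≤s p) = get-++ˡ xs ys (suc j) p

get-++-∷ : ∀ xs y ys → get (xs ++ y ∷ ys) (suc (length xs)) ≡ y
get-++-∷ []       y ys = refl
get-++-∷ (x ∷ xs) y ys = get-++-∷ xs y ys

get-++-∷-≢ : ∀ xs y z ys j → j ≢ suc (length xs) →
  get (xs ++ y ∷ ys) j ≡ get (xs ++ z ∷ ys) j
get-++-∷-≢ []       y z ys zero          _  = refl
get-++-∷-≢ []       y z ys (suc zero)    ne = ⊥-elim (ne refl)
get-++-∷-≢ []       y z ys (suc (suc j)) _  = refl
get-++-∷-≢ (x ∷ xs) y z ys zero          _  = refl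
get-++-∷-≢ (x ∷ xs) y z ys (suc zero)    _  = refl
get-++-∷-≢ (x ∷ xs) y z ys (suc (suc j)) ne = get-++-∷-≢ xs y z ys (suc j) (ne ∘′ cong suc)

get-take : ∀ n xs j → j ≤ n → get (take n xs) j ≡ get xs j
get-take n       xs       zero          _       = trans (get-zero (take n xs)) (sym (get-zero xs))
get-take (suc n) []       (suc j)       _       = refl
get-take (suc n) (x ∷ xs) (suc zero)    _       = refl
get-take (suc n) (x ∷ xs) (suc (suc j)) (s≤s p) = get-take n xs (suc j) p

get-All : ∀ {P : ℕ → Set} xs j → All P xs → 1 ≤ j → j ≤ length xs → P (get xs j)
get-All (x ∷ xs) (suc zero)    (px ∷ _)   _ _       = px
get-All (x ∷ xs) (suc (suc j)) (_  ∷ pxs) _ (s≤s p) = get-All xs (suc j) pxs (s≤s z≤n) p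

get-replicate : ∀ n i → 1 ≤ i → i ≤ n → get (replicate n 1) i ≡ 1
get-replicate (suc n) (suc zero)    _ _       = refl
get-replicate (suc n) (suc (suc i)) _ (s≤s p) = get-replicate n (suc i) (s≤s z≤n) p

get-replicate-≤ : ∀ n j → get (replicate n 1) j ≤ 1
get-replicate-≤ zero    j             = z≤n
get-replicate-≤ (suc n) zero          = z≤n
get-replicate-≤ (suc n) (suc zero)    = ≤-refl
get-replicate-≤ (suc n) (suc (suc j)) = get-replicate-≤ n (suc j)

take-suc-get : ∀ t xs → suc t ≤ length xs → take (suc t) xs ≡ take t xs ++ [ get xs (suc t) ]
take-suc-get zero    (x ∷ xs) _       = refl
take-suc-get (suc t) (x ∷ xs) (s≤s p) = cong (x ∷_) (take-suc-get t xs p)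

take-++ˡ : ∀ n (xs ys : List ℕ) → n ≤ length xs → take n (xs ++ ys) ≡ take n xs
take-++ˡ zero    xs       ys _       = refl
take-++ˡ (suc n) (x ∷ xs) ys (s≤s p) = cong (x ∷_) (take-++ˡ n xs ys p)

take-+ : ∀ m n (xs : List ℕ) → take (m + n) xs ≡ take m xs ++ take n (drop m xs)
take-+ zero    n       xs       = refl
take-+ (suc m) zero    []       = refl
take-+ (suc m) (suc n) []       = refl
take-+ (suc m) n       (x ∷ xs) = cong (x ∷_) (take-+ m n xs)

length-take-≤ : ∀ n (xs : List ℕ) → n ≤ length xs → length (take n xs) ≡ n
length-take-≤ n xs p = trans (length-take n xs) (m≤n⇒m⊓n≡m p)

length-snoc : ∀ (xs : List ℕ) x → length (xs ++ [ x ]) ≡ suc (length xs)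
length-snoc xs x = trans (length-++ xs) (+-comm (length xs) 1)

count-++ : ∀ a xs ys → count a (xs ++ ys) ≡ count a xs + count a ys
count-++ a []       ys = refl
count-++ a (x ∷ xs) ys with a ≟ x
... | yes _ = cong suc (count-++ a xs ys)
... | no  _ = count-++ a xs ys

count-∷-self : ∀ a xs → count a (a ∷ xs) ≡ suc (count a xs)
count-∷-self a xs with a ≟ a
... | yes _ = refl
... | no ne = ⊥-elim (ne refl)

count-∷-≢ : ∀ a x xs → a ≢ x → count a (x ∷ xs) ≡ count a xs
count-∷-≢ a x xs ne with a ≟ x
... | yes e = ⊥-elim (ne e)
... | no  _ = refl

count-∷-≥ : ∀ a x xs → count a xs ≤ count a (x ∷ xs)
count-∷-≥ a x xs with a ≟ x
... | yes _ = n≤1+n _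
... | no  _ = ≤-refl

count-snoc-self : ∀ a xs → count a (xs ++ [ a ]) ≡ suc (count a xs)
count-snoc-self a xs = trans (count-++ a xs [ a ]) (trans (cong (count a xs +_) (count-∷-self a [])) (+-comm (count a xs) 1))

count-snoc-≢ : ∀ a x xs → a ≢ x → count a (xs ++ [ x ]) ≡ count a xs
count-snoc-≢ a x xs ne = trans (count-++ a xs [ x ]) (trans (cong (count a xs +_) (count-∷-≢ a x [] ne)) (+-identityʳ _))

maximum : List ℕ → ℕ
maximum = foldr _⊔_ 0

maximum-++ : ∀ xs ys → maximum (xs ++ ys) ≡ maximum xs ⊔ maximum ys
maximum-++ []       ys = refl
maximum-++ (x ∷ xs) ys = trans (cong (x ⊔_) (maximum-++ xs ys)) (sym (⊔-assoc x (maximum xs) (maximum ys)))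

maximum-snoc : ∀ xs x → maximum (xs ++ [ x ]) ≡ maximum xs ⊔ x
maximum-snoc xs x = trans (maximum-++ xs [ x ]) (cong (maximum xs ⊔_) (⊔-identityʳ x))

count-> : ∀ a xs → maximum xs < a → count a xs ≡ 0
count-> a []       _  = refl
count-> a (x ∷ xs) lt with a ≟ x
... | yes refl = ⊥-elim (<-irrefl refl (≤-<-trans (m≤m⊔n x (maximum xs)) lt))
... | no  _    = count-> a xs (≤-<-trans (m≤n⊔m x (maximum xs)) lt)

count-maximum : ∀ xs → 1 ≤ maximum xs → 1 ≤ count (maximum xs) xs
count-maximum (x ∷ xs) pos with ⊔-sel x (maximum xs)
... | inj₂ e rewrite e = ≤-trans (count-maximum xs pos) (count-∷-≥ _ x xs)
... | inj₁ e rewrite e | count-∷-self x xs = s≤s z≤n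

maximum-take-suc : ∀ t xs → suc t ≤ length xs →
  maximum (take (suc t) xs) ≡ maximum (take t xs) ⊔ get xs (suc t)
maximum-take-suc t xs p = trans (cong maximum (take-suc-get t xs p)) (maximum-snoc (take t xs) _)

maximum-take-stable : ∀ xs a e → a + e ≤ length xs →
  (∀ x → a < x → x ≤ a + e → get xs x ≤ maximum (take a xs)) →
  maximum (take (a + e) xs) ≡ maximum (take a xs)
maximum-take-stable xs a zero    _   _     = cong (λ n → maximum (take n xs)) (+-identityʳ a)
maximum-take-stable xs a (suc e) len bound = begin
  maximum (take (a + suc e) xs)                      ≡⟨ cong (λ n → maximum (take n xs)) (+-suc a e) ⟩
  maximum (take (suc (a + e)) xs)                    ≡⟨ maximum-take-suc (a + e) xs len′ ⟩
  maximum (take (a + e) xs) ⊔ get xs (suc (a + e))   ≡⟨ cong (_⊔ get xs (suc (a + e))) IH ⟩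
  maximum (take a xs) ⊔ get xs (suc (a + e))         ≡⟨ m≥n⇒m⊔n≡m (bound _ (s≤s (m≤m+n a e)) (≤-reflexive (sym (+-suc a e)))) ⟩
  maximum (take a xs)                                ∎
  where
  open ≡-Reasoning
  len′ : suc (a + e) ≤ length xs
  len′ = subst (_≤ length xs) (+-suc a e) len
  IH : maximum (take (a + e) xs) ≡ maximum (take a xs)
  IH = maximum-take-stable xs a e (≤-trans (+-monoʳ-≤ a (n≤1+n e)) len)
         (λ x a<x x≤ → bound x a<x (≤-trans x≤ (+-monoʳ-≤ a (n≤1+n e))))

m⊔n≡o∧m<o⇒n≡o : ∀ {m n o} → m ⊔ n ≡ o → m < o → n ≡ o
m⊔n≡o∧m<o⇒n≡o {m} {n} e m<o with ⊔-sel m n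
... | inj₁ m⊔n≡m = ⊥-elim (<⇒≢ m<o (trans (sym m⊔n≡m) e))
... | inj₂ m⊔n≡n = trans (sym m⊔n≡n) e

≡-by-unit-steps : (f : ℕ → ℕ) (m p : ℕ) → m ≤ p →
  (∀ v → m < v → v ≤ p → f (pred v) ≡ f v) → f m ≡ f p
≡-by-unit-steps f m zero    z≤n  step = refl
≡-by-unit-steps f m (suc p) m≤1+p step with m≤n⇒m<n∨m≡n m≤1+p
... | inj₂ refl       = refl
... | inj₁ (s≤s m≤p) =
  trans (≡-by-unit-steps f m p m≤p (λ v m<v v≤p → step v m<v (m≤n⇒m≤1+n v≤p)))
        (step (suc p) (s≤s m≤p) ≤-refl)

-- Blocks of a composition

sum-take-≤ : ∀ l δ → sum (take l δ) ≤ sum δ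
sum-take-≤ zero    δ       = z≤n
sum-take-≤ (suc l) []      = z≤n
sum-take-≤ (suc l) (d ∷ δ) = +-monoʳ-≤ d (sum-take-≤ l δ)

sum-take-mono : ∀ m n δ → m ≤ n → sum (take m δ) ≤ sum (take n δ)
sum-take-mono zero    n       δ       _       = z≤n
sum-take-mono (suc m) (suc n) []      _       = z≤n
sum-take-mono (suc m) (suc n) (d ∷ δ) (s≤s p) = +-monoʳ-≤ d (sum-take-mono m n δ p)

sum-take-suc : ∀ l δ → l < length δ → sum (take (suc l) δ) ≡ sum (take l δ) + get δ (suc l)
sum-take-suc zero    (d ∷ δ) _       = +-identityʳ d
sum-take-suc (suc l) (d ∷ δ) (s≤s p) =
  trans (cong (d +_) (sum-take-suc l δ p)) (sym (+-assoc d (sum (take l δ)) (get δ (suc l))))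

-- Position t + 1, not t, is the first of its block.
BlockStart : List ℕ → ℕ → Set
BlockStart δ t = ∀ ℓ → 1 ≤ ℓ → ℓ ≤ length δ → zStart δ ℓ ≤ t → suc t ≤ zEnd δ ℓ → ⊥

BlockStart-sum-take : ∀ δ l → BlockStart δ (sum (take l δ))
BlockStart-sum-take δ l ℓ _ _ zℓ≤s s<zEndℓ with ℓ ≤? l
... | yes ℓ≤l = <-irrefl refl (≤-<-trans (sum-take-mono ℓ l δ ℓ≤l) s<zEndℓ)
... | no  ℓ≰l = <-irrefl refl (<-≤-trans (≤-<-trans (sum-take-mono l (ℓ ∸ 1) δ (l≤ℓ∸1 (≰⇒> ℓ≰l))) (m<m+n _ (s≤s z≤n))) zℓ≤s)
  where
  l≤ℓ∸1 : ∀ {ℓ} → suc l ≤ ℓ → l ≤ ℓ ∸ 1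
  l≤ℓ∸1 (s≤s q) = q

-- Extending a lattice permutation

Lattice⇒count-antitone : ∀ xs → Lattice xs → ∀ a b → 1 ≤ a → a ≤ b → count b xs ≤ count a xs
Lattice⇒count-antitone xs L a b 1≤a a≤b with m≤n⇒m<n∨m≡n a≤b
... | inj₂ refl = ≤-refl
... | inj₁ a<b  = subst (λ ys → count b ys ≤ count a ys) (take-all (length xs) xs ≤-refl)
                    (L (length xs) ≤-refl a b 1≤a a<b)

-- Appending v keeps the lattice property iff v − 1 is strictly more frequent than v.
LatticeStep : List ℕ → ℕ → Set
LatticeStep xs v = 2 ≤ v → count v xs < count (pred v) xs

snoc-count-antitone : ∀ xs v → Lattice xs → LatticeStep xs v → ∀ a b → 1 ≤ a → a < b →
  count b (xs ++ [ v ]) ≤ count a (xs ++ [ v ])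
snoc-count-antitone xs v L step a b 1≤a a<b with b ≟ v
... | no b≢v rewrite count-snoc-≢ b v xs b≢v | count-++ a xs [ v ] =
  ≤-trans (Lattice⇒count-antitone xs L a b 1≤a (<⇒≤ a<b)) (m≤m+n _ _)
snoc-count-antitone xs v L step a (suc b) 1≤a (s≤s a≤b) | yes refl
  rewrite count-snoc-self (suc b) xs | count-++ a xs [ suc b ] =
  ≤-trans (step (s≤s (≤-trans 1≤a a≤b)))
    (≤-trans (Lattice⇒count-antitone xs L a b 1≤a a≤b) (m≤m+n _ _))

Lattice-snoc : ∀ xs v → Lattice xs → LatticeStep xs v → Lattice (xs ++ [ v ])
Lattice-snoc xs v L step k k≤ a b 1≤a a<b with k ≤? length xs
... | yes k≤xs rewrite take-++ˡ k xs [ v ] k≤xs = L k k≤xs a b 1≤a a<b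
... | no  k≰xs rewrite take-all k (xs ++ [ v ]) (subst (_≤ k) (sym (length-snoc xs v)) (≰⇒> k≰xs)) =
  snoc-count-antitone xs v L step a b 1≤a a<b

Lattice-snoc⇒≤suc-maximum : ∀ xs c → Lattice (xs ++ [ c ]) → c ≤ suc (maximum xs)
Lattice-snoc⇒≤suc-maximum xs zero    L = z≤n
Lattice-snoc⇒≤suc-maximum xs (suc c) L with c ≤? maximum xs
... | yes c≤max = s≤s c≤max
... | no  c≰max = ⊥-elim (1+n≰0 (subst₂ _≤_ (count-snoc-self (suc c) xs) count-c≡0 antitone))
  where
  max<c : maximum xs < c
  max<c = ≰⇒> c≰max
  antitone : count (suc c) (xs ++ [ suc c ]) ≤ count c (xs ++ [ suc c ])
  antitone = Lattice⇒count-antitone _ L c (suc c) (≤-trans (s≤s z≤n) max<c) (n≤1+n c)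
  count-c≡0 : count c (xs ++ [ suc c ]) ≡ 0
  count-c≡0 = trans (count-snoc-≢ c (suc c) xs (<⇒≢ (n<1+n c))) (count-> c xs max<c)
  1+n≰0 : ∀ {n} → suc n ≤ 0 → ⊥
  1+n≰0 ()

LatticeStep-suc-maximum : ∀ xs → LatticeStep xs (suc (maximum xs))
LatticeStep-suc-maximum xs (s≤s 1≤max) rewrite count-> (suc (maximum xs)) xs ≤-refl =
  count-maximum xs 1≤max

-- Extending a δ-nonincreasing sequence

BlockCompatible : List ℕ → List ℕ → ℕ → Set
BlockCompatible δ xs v = ∀ ℓ → 1 ≤ ℓ → ℓ ≤ length δ →
  zStart δ ℓ ≤ length xs → suc (length xs) ≤ zEnd δ ℓ → v ≤ get xs (length xs)

m∸n≡suc[m∸suc[n]] : ∀ m n → n < m → m ∸ n ≡ suc (m ∸ suc n)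
m∸n≡suc[m∸suc[n]] (suc m) zero    _       = refl
m∸n≡suc[m∸suc[n]] (suc m) (suc n) (s≤s p) = m∸n≡suc[m∸suc[n]] m n p

pad-short : ∀ δ xs → length xs < sum δ →
  pad δ xs ≡ xs ++ 1 ∷ replicate (sum δ ∸ suc (length xs)) 1
pad-short δ xs lt = cong (λ n → xs ++ replicate n 1) (m∸n≡suc[m∸suc[n]] (sum δ) (length xs) lt)

pad-snoc : ∀ δ xs v → pad δ (xs ++ [ v ]) ≡ xs ++ v ∷ replicate (sum δ ∸ suc (length xs)) 1
pad-snoc δ xs v rewrite length-snoc xs v = ++-assoc xs [ v ] _

BlockNonincreasing : List ℕ → List ℕ → Set
BlockNonincreasing δ ys = ∀ ℓ → 1 ≤ ℓ → ℓ ≤ length δ → ∀ i j →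
  zStart δ ℓ ≤ i → i ≤ j → j ≤ zEnd δ ℓ → get ys j ≤ get ys i

-- The padded sequence changes only at position |xs| + 1, from 1 to v ≥ 1.
DeltaNonincreasing-snoc : ∀ δ xs v → DeltaNonincreasing δ xs → length xs < sum δ → 1 ≤ v →
  BlockCompatible δ xs v → DeltaNonincreasing δ (xs ++ [ v ])
DeltaNonincreasing-snoc δ xs v (_ , D) lt 1≤v compatible =
  subst (_≤ sum δ) (sym (length-snoc xs v)) lt , subst (BlockNonincreasing δ) (sym (pad-snoc δ xs v)) goal
  where
  R = replicate (sum δ ∸ suc (length xs)) 1
  n = suc (length xs)
  old : BlockNonincreasing δ (xs ++ 1 ∷ R)
  old = subst (BlockNonincreasing δ) (pad-short δ xs lt) D
  goal : BlockNonincreasing δ (xs ++ v ∷ R)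
  goal ℓ a b i j zi ij jz with j ≟ n | i ≟ n
  ... | no j≢n | no i≢n rewrite get-++-∷-≢ xs v 1 R j j≢n | get-++-∷-≢ xs v 1 R i i≢n =
    old ℓ a b i j zi ij jz
  ... | yes refl | yes refl = ≤-refl
  ... | no j≢n | yes refl rewrite get-++-∷-≢ xs v 1 R j j≢n | get-++-∷ xs v R =
    ≤-trans (old ℓ a b n j zi ij jz) (≤-trans (≤-reflexive (get-++-∷ xs 1 R)) 1≤v)
  ... | yes refl | no i≢n = begin
    get (xs ++ v ∷ R) n            ≡⟨ get-++-∷ xs v R ⟩
    v                              ≤⟨ compatible ℓ a b (≤-trans zi i≤xs) jz ⟩
    get xs (length xs)             ≡⟨ get-++ˡ xs (1 ∷ R) (length xs) ≤-refl ⟨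
    get (xs ++ 1 ∷ R) (length xs)  ≤⟨ old ℓ a b i (length xs) zi i≤xs (≤-trans (n≤1+n _) jz) ⟩
    get (xs ++ 1 ∷ R) i            ≡⟨ get-++ˡ xs (1 ∷ R) i i≤xs ⟩
    get xs i                       ≡⟨ get-++ˡ xs (v ∷ R) i i≤xs ⟨
    get (xs ++ v ∷ R) i            ∎
    where
    open ≤-Reasoning
    i≤xs : i ≤ length xs
    i≤xs = s≤s⁻¹ (≤∧≢⇒< ij i≢n)

Admissible-[] : ∀ δ → Admissible δ []
Admissible-[] δ = [] , lattice , z≤n , nonincreasing
  where
  lattice : Lattice []
  lattice .zero z≤n a b _ _ = z≤n
  nonincreasing : BlockNonincreasing δ (pad δ [])
  nonincreasing ℓ _ _ i j zi ij jz
    rewrite get-replicate (sum δ) i (≤-trans (m≤n+m 1 _) zi) (≤-trans ij (≤-trans jz (sum-take-≤ ℓ δ))) =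
    get-replicate-≤ (sum δ) j

Admissible-snoc : ∀ δ xs v → Admissible δ xs → length xs < sum δ → 1 ≤ v →
  LatticeStep xs v → BlockCompatible δ xs v → Admissible δ (xs ++ [ v ])
Admissible-snoc δ xs v (pos , L , D) lt 1≤v step compatible =
  ++⁺ pos (1≤v ∷ []) , Lattice-snoc xs v L step , DeltaNonincreasing-snoc δ xs v D lt 1≤v compatible

module MinimalSequence (δ ω : List ℕ) (composition : Composition δ) (minimal : IsMinimalSeq δ ω) where

  length-ω : length ω ≡ sum δ
  length-ω = proj₁ minimal

  admissible : ∀ n → 1 ≤ n → n ≤ length ω → Admissible δ (take n ω)
  admissible n 1≤n n≤ω = proj₁ (proj₂ minimal n 1≤n n≤ω)

  admissible-before : ∀ t → suc t ≤ length ω → Admissible δ (take t ω)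
  admissible-before zero    _ = Admissible-[] δ
  admissible-before (suc t) p = admissible (suc t) (s≤s z≤n) (≤-trans (n≤1+n _) p)

  greedy : ∀ t → suc t ≤ length ω → ∀ v → get ω (suc t) < v → ¬ Admissible δ (take t ω ++ [ v ])
  greedy t p = proj₂ (proj₂ minimal (suc t) (s≤s z≤n) p)

  prefixMax : ℕ → ℕ
  prefixMax t = maximum (take t ω)

  length-prefix : ∀ t → t ≤ length ω → length (take t ω) ≡ t
  length-prefix t p = length-take-≤ t ω p

  prefix-short : ∀ t → suc t ≤ length ω → length (take t ω) < sum δ
  prefix-short t p rewrite length-prefix t (≤-trans (n≤1+n _) p) = subst (t <_) length-ω p

  next≤suc-prefixMax : ∀ t → suc t ≤ length ω → get ω (suc t) ≤ suc (prefixMax t)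
  next≤suc-prefixMax t p = Lattice-snoc⇒≤suc-maximum (take t ω) (get ω (suc t))
    (subst Lattice (take-suc-get t ω p) (proj₁ (proj₂ (admissible (suc t) (s≤s z≤n) p))))

  next≡suc-prefixMax : ∀ t → suc t ≤ length ω → BlockStart δ t → get ω (suc t) ≡ suc (prefixMax t)
  next≡suc-prefixMax t p start with suc (prefixMax t) ≤? get ω (suc t)
  ... | yes ≥ = ≤-antisym (next≤suc-prefixMax t p) ≥
  ... | no  ≱ = ⊥-elim (greedy t p _ (≰⇒> ≱)
    (Admissible-snoc δ (take t ω) _ (admissible-before t p) (prefix-short t p) (s≤s z≤n)
      (LatticeStep-suc-maximum (take t ω)) compatible))
    where
    compatible : BlockCompatible δ (take t ω) (suc (prefixMax t))
    compatible ℓ a b z e rewrite length-prefix t (≤-trans (n≤1+n _) p) = ⊥-elim (start ℓ a b z e)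

  ω-nonincreasing : ∀ ℓ → 1 ≤ ℓ → ℓ ≤ length δ → ∀ i j → zStart δ ℓ ≤ i → i ≤ j → j ≤ zEnd δ ℓ →
    1 ≤ j → j ≤ length ω → get ω j ≤ get ω i
  ω-nonincreasing ℓ a b i j zi ij jz 1≤j j≤ω =
    subst₂ _≤_ (agree j ≤-refl) (agree i ij) (proj₂ (proj₂ (proj₂ (admissible j 1≤j j≤ω))) ℓ a b i j zi ij jz)
    where
    agree : ∀ k → k ≤ j → get (pad δ (take j ω)) k ≡ get ω k
    agree k k≤j = trans (get-++ˡ (take j ω) _ k (subst (k ≤_) (sym (length-prefix j j≤ω)) k≤j)) (get-take j ω k k≤j)

  block-within-ω : ∀ l → l < length δ → sum (take (suc l) δ) ≤ length ω
  block-within-ω l _ = subst (sum (take (suc l) δ) ≤_) (sym length-ω) (sum-take-≤ (suc l) δ)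

  block-nonempty : ∀ l → l < length δ → 1 ≤ get δ (suc l)
  block-nonempty l p = get-All δ (suc l) composition (s≤s z≤n) p

  blockStart≡suc-prefixMax : ∀ l → l < length δ →
    get ω (suc (sum (take l δ))) ≡ suc (prefixMax (sum (take l δ)))
  blockStart≡suc-prefixMax l p = next≡suc-prefixMax _ start≤ω (BlockStart-sum-take δ l)
    where
    start≤ω : suc (sum (take l δ)) ≤ length ω
    start≤ω = ≤-trans (subst (_≤ sum (take l δ) + get δ (suc l)) (+-comm (sum (take l δ)) 1)
                              (+-monoʳ-≤ _ (block-nonempty l p)))
                      (subst (_≤ length ω) (sum-take-suc l δ p) (block-within-ω l p))

  prefixMax-block : ∀ l → l < length δ →
    prefixMax (sum (take (suc l) δ)) ≡ suc (prefixMax (sum (take l δ)))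
  prefixMax-block l p with get δ (suc l) | block-nonempty l p | sum-take-suc l δ p
  ... | suc e | _ | sum≡ = begin
    prefixMax (sum (take (suc l) δ)) ≡⟨ cong prefixMax end≡ ⟩
    prefixMax (suc s + e)            ≡⟨ maximum-take-stable ω (suc s) e end≤ω rest≤start ⟩
    prefixMax (suc s)                ≡⟨ prefixMax-start ⟩
    suc (prefixMax s)                ∎
    where
    open ≡-Reasoning
    s = sum (take l δ)
    end≡ : sum (take (suc l) δ) ≡ suc s + e
    end≡ = trans sum≡ (+-suc s e)
    end≤ω : suc s + e ≤ length ω
    end≤ω = subst (_≤ length ω) end≡ (block-within-ω l p)
    start : get ω (suc s) ≡ suc (prefixMax s)
    start = blockStart≡suc-prefixMax l p
    prefixMax-start : prefixMax (suc s) ≡ suc (prefixMax s)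
    prefixMax-start = begin
      prefixMax (suc s)                ≡⟨ maximum-take-suc s ω (≤-trans (m≤m+n (suc s) e) end≤ω) ⟩
      prefixMax s ⊔ get ω (suc s)      ≡⟨ cong (prefixMax s ⊔_) start ⟩
      prefixMax s ⊔ suc (prefixMax s)  ≡⟨ m≤n⇒m⊔n≡n (n≤1+n _) ⟩
      suc (prefixMax s)                ∎
    rest≤start : ∀ x → suc s < x → x ≤ suc s + e → get ω x ≤ prefixMax (suc s)
    rest≤start x s<x x≤end = subst (get ω x ≤_) (trans start (sym prefixMax-start))
      (ω-nonincreasing (suc l) (s≤s z≤n) p (suc s) x (≤-reflexive (+-comm s 1)) (<⇒≤ s<x)
        (subst (x ≤_) (sym end≡) x≤end) (≤-trans (s≤s z≤n) s<x) (≤-trans x≤end end≤ω))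

  prefixMax-blocks : ∀ l → l ≤ length δ → prefixMax (sum (take l δ)) ≡ l
  prefixMax-blocks zero    _ = refl
  prefixMax-blocks (suc l) p =
    trans (prefixMax-block l p) (cong suc (prefixMax-blocks l (≤-trans (n≤1+n _) p)))

  blockStart-value : (ℓ : ℕ) → 1 ≤ ℓ → ℓ ≤ length δ → get ω (zStart δ ℓ) ≡ ℓ
  blockStart-value (suc l) _ p rewrite +-comm (sum (take l δ)) 1 =
    trans (blockStart≡suc-prefixMax l p) (cong suc (prefixMax-blocks l (≤-trans (n≤1+n _) p)))

  blockMax-value : (ℓ : ℕ) → 1 ≤ ℓ → ℓ ≤ length δ → blockMax δ ω ℓ ≡ ℓ
  blockMax-value (suc l) _ p rewrite m+n∸n≡m (sum (take l δ)) 1 =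
    m⊔n≡o∧m<o⇒n≡o (begin
      prefixMax s ⊔ maximum block        ≡⟨ sym (maximum-++ (take s ω) block) ⟩
      maximum (take s ω ++ block)        ≡⟨ cong maximum (sym (take-+ s (get δ (suc l)) ω)) ⟩
      prefixMax (s + get δ (suc l))      ≡⟨ cong prefixMax (sym (sum-take-suc l δ p)) ⟩
      prefixMax (sum (take (suc l) δ))   ≡⟨ prefixMax-blocks (suc l) p ⟩
      suc l                              ∎)
      (≤-reflexive (cong suc (prefixMax-blocks l (≤-trans (n≤1+n _) p))))
    where
    open ≡-Reasoning
    s = sum (take l δ)
    block = take (get δ (suc l)) (drop s ω)

  descent-counts : (i : ℕ) → 1 ≤ i → suc i ≤ length ω → get ω (suc i) < get ω i →
    count (get ω (suc i)) (take i ω) ≡ count (get ω i) (take i ω)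
  descent-counts i 1≤i p m<p = ≡-by-unit-steps (λ a → count a P) _ _ (<⇒≤ m<p) step
    where
    P = take i ω
    i≤ω : i ≤ length ω
    i≤ω = ≤-trans (n≤1+n _) p
    compatible : ∀ v → v ≤ get ω i → BlockCompatible δ P v
    compatible v v≤ _ _ _ _ _ rewrite length-prefix i i≤ω | get-take i ω i ≤-refl = v≤
    ¬LatticeStep : ∀ v → get ω (suc i) < v → v ≤ get ω i → ¬ LatticeStep P v
    ¬LatticeStep v m<v v≤p latticeStep = greedy i p v m<v
      (Admissible-snoc δ P v (admissible i 1≤i i≤ω) (prefix-short i p) (≤-trans (s≤s z≤n) m<v)
        latticeStep (compatible v v≤p))
    step : ∀ v → get ω (suc i) < v → v ≤ get ω i → count (pred v) P ≡ count v P
    step (suc zero) m<v v≤p = ⊥-elim (¬LatticeStep 1 m<v v≤p (λ { (s≤s ()) }))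
    step (suc (suc v)) m<v v≤p with count (suc (suc v)) P <? count (suc v) P
    ... | yes more = ⊥-elim (¬LatticeStep _ m<v v≤p (λ _ → more))
    ... | no  ¬more = ≤-antisym (≮⇒≥ ¬more)
      (Lattice⇒count-antitone P (proj₁ (proj₂ (admissible i 1≤i i≤ω))) (suc v) (suc (suc v)) (s≤s z≤n) (n≤1+n _))

proposition6p5 : (δ ω : List ℕ) → Composition δ → IsMinimalSeq δ ω →
    ((ℓ : ℕ) → 1 ≤ ℓ → ℓ ≤ length δ → get ω (zStart δ ℓ) ≡ ℓ)
    × ((ℓ : ℕ) → 1 ≤ ℓ → ℓ ≤ length δ → blockMax δ ω ℓ ≡ ℓ)
    × ((i : ℕ) → 1 ≤ i → suc i ≤ length ω → get ω (suc i) < get ω i →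
        count (get ω (suc i)) (take i ω) ≡ count (get ω i) (take i ω))
proposition6p5 δ ω composition minimal =
  blockStart-value , blockMax-value , descent-counts
  where open MinimalSequence δ ω composition minimal
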